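{- Let $G$ be a finite loopless graph with edges ordered $e_1,\dots,e_m$, and let $\mathcal W=\{w_1,\dots,w_k\}$ be a set of edge weightings $w_i:E(G)\to\{0,1,2,\dots\}$. Let $\Pi(\mathcal W)$ be the set of star labellings of $G$ whose exponent belongs to $\mathcal W$. If the integer $\sum_{\pi\in\Pi(\mathcal W)}\operatorname{sgn}(\pi)$ is nonzero, then $G$ is $(w_i+\mathbf 1)$-edge choosable for some $i\in\{1,\dots,k\}$, where $w_i+\mathbf 1$ denotes the function $e\mapsto w_i(e)+1$.
   Context: For $f:E(G)\to\mathbb N$, $G$ is $f$-edge choosable if for every assignment $L$ of colour sets to edges with $|L(e)|\ge f(e)$ for all $e$, there is a proper edge colouring $c$ with $c(e)\in L(e)$ for all $e$. A star labelling at a vertex $v$ of degree $d$ is a bijection $\pi_v$ from the edges incident with $v$ to $\{0,1,\dots,d-1\}$. A star labelling of $G$ is a family $\pi=\{\pi_v: v\in V(G)\}$ of star labellings at each vertex. Its exponent is the edge weighting $w_\pi$ with $w_\pi(e)=\pi_u(e)+\pi_v(e)$ for $e=uv$. The sign of $\pi_v$ is the sign of the permutation $j\mapsto \pi_v(e_{i_j})$ of $\{0,\dots,d-1\}$, where $e_{i_0},\dots,e_{i_{d-1}}$ are the edges incident with $v$ with $i_0<i_1<\dots<i_{d-1}$; and $\operatorname{sgn}(\pi)=\prod_{v\in V(G)}\operatorname{sgn}(\pi_v)$. -}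

module Defs where

open import Data.Nat as ℕ using (ℕ; zero; suc; _+_; _≤_; _<?_)
open import Data.Nat.Properties using () renaming (_≟_ to _≟ℕ_)
open import Data.Fin using (Fin; zero; suc)
open import Data.Fin.Properties using (all?; any?) renaming (_≟_ to _≟F_)
open import Data.Integer using (ℤ; +_; -_) renaming (_*_ to _*ℤ_; _^_ to _^ℤ_)
open import Data.List using (List; []; _∷_; [_]; map; filter; concatMap; length; upTo; allFin; foldr; sum)
open import Data.List.Membership.Propositional using (_∈_)
open import Data.List.Relation.Unary.Unique.Propositional using (Unique)
import Data.List.Relation.Unary.Unique.DecPropositional as UD
open import Data.Product using (Σ; ∃; ∃-syntax; _×_; _,_; proj₁; proj₂)
open import Data.Sum using (_⊎_)
open import Data.Bool using (if_then_else_)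
open import Relation.Nullary using (¬_; does)
open import Relation.Nullary.Decidable using (_⊎-dec_)
open import Relation.Binary.PropositionalEquality using (_≡_; _≢_)

-- Finite loopless (multi)graphs on vertices Fin n with edges e_1..e_m,
-- indexed by Fin m in this order; edge e joins ends e = (u , v), u ≢ v.

record Graph : Set where
  field
    n : ℕ
    m : ℕ
    ends : Fin m → Fin n × Fin n
    loopless : ∀ e → proj₁ (ends e) ≢ proj₂ (ends e)

module _ (G : Graph) where
  open Graph G

  Incident : Fin n → Fin m → Set
  Incident v e = v ≡ proj₁ (ends e) ⊎ v ≡ proj₂ (ends e)

  incident? : ∀ v e → Relation.Nullary.Dec (Incident v e)
  incident? v e = (v ≟F proj₁ (ends e)) ⊎-dec (v ≟F proj₂ (ends e))

  incEdges : Fin n → List (Fin m)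
  incEdges v = filter (incident? v) (allFin m)

  deg : Fin n → ℕ
  deg v = length (incEdges v)

  -- Edge choosability (colours are natural numbers; L e is a list of
  -- distinct colours, so |L e| = length (L e)).

  Adjacent : Fin m → Fin m → Set
  Adjacent e e' = e ≢ e' × ∃[ v ] (Incident v e × Incident v e')

  IsProperEdgeColouring : (Fin m → ℕ) → Set
  IsProperEdgeColouring c = ∀ e e' → Adjacent e e' → c e ≢ c e'

  EdgeChoosable : (Fin m → ℕ) → Set
  EdgeChoosable f =
    (L : Fin m → List ℕ) → (∀ e → Unique (L e)) → (∀ e → f e ≤ length (L e)) →
    ∃[ c ] (IsProperEdgeColouring c × (∀ e → c e ∈ L e))

tuples : ℕ → ℕ → List (List ℕ)
tuples zero d = [ [] ]
tuples (suc k) d = concatMap (λ x → map (x ∷_) (tuples k d)) (upTo d)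

-- bijections {0..d-1} → {0..d-1}, written as the list of their values
-- (value at j is the j-th entry): the injective tuples of length d.
bijections : ℕ → List (List ℕ)
bijections d = filter (UD.unique? _≟ℕ_) (tuples d d)

choices : (k : ℕ) {A : Fin k → Set} → ((i : Fin k) → List (A i)) → List ((i : Fin k) → A i)
choices zero S = [ (λ ()) ]
choices (suc k) {A} S =
  concatMap (λ a → map (λ f → cons a f) (choices k (λ i → S (suc i)))) (S zero)
  where
  cons : A zero → ((i : Fin k) → A (suc i)) → (i : Fin (suc k)) → A i
  cons a f zero = a
  cons a f (suc i) = f i

inversions : List ℕ → ℕ
inversions [] = 0
inversions (x ∷ xs) = length (filter (_<? x) xs) + inversions xs

sign : List ℕ → ℤ
sign ℓ = (- (+ 1)) ^ℤ inversions ℓ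

productℤ : List ℤ → ℤ
productℤ = foldr _*ℤ_ (+ 1)

sumℤ : List ℤ → ℤ
sumℤ = foldr Data.Integer._+_ (+ 0)

module _ (G : Graph) where
  open Graph G

  -- A star labelling at v is encoded as the list (π_v(e_{i_0}), ..., π_v(e_{i_{d-1}}))
  -- which is a bijection onto {0,...,d-1}; its sign is the sign of j ↦ π_v(e_{i_j}).
  starLabellingsAt : (v : Fin n) → List (List ℕ)
  starLabellingsAt v = bijections (deg G v)

  StarLabelling : Set
  StarLabelling = Fin n → List ℕ

  starLabellings : List StarLabelling
  starLabellings = choices n starLabellingsAt

  labelAt : List (Fin m) → List ℕ → Fin m → ℕ
  labelAt (x ∷ xs) (l ∷ ls) e = if does (x ≟F e) then l else labelAt xs ls e
  labelAt _ _ e = 0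

  starLabel : StarLabelling → Fin n → Fin m → ℕ
  starLabel π v e = labelAt (incEdges G v) (π v) e

  exponent : StarLabelling → Fin m → ℕ
  exponent π e = starLabel π (proj₁ (ends e)) e + starLabel π (proj₂ (ends e)) e

  sgn : StarLabelling → ℤ
  sgn π = productℤ (map (λ v → sign (π v)) (allFin n))

  InWeightings : {k : ℕ} → (Fin k → Fin m → ℕ) → (Fin m → ℕ) → Set
  InWeightings W w = ∃[ i ] (∀ e → w e ≡ W i e)

  inWeightings? : {k : ℕ} (W : Fin k → Fin m → ℕ) (w : Fin m → ℕ) → Relation.Nullary.Dec (InWeightings W w)
  inWeightings? W w = any? (λ i → all? (λ e → w e ≟ℕ W i e))

  Π : {k : ℕ} → (Fin k → Fin m → ℕ) → List StarLabelling
  Π W = filter (λ π → inWeightings? W (exponent π)) starLabellings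

  signSum : {k : ℕ} → (Fin k → Fin m → ℕ) → ℤ
  signSum W = sumℤ (map sgn (Π W))

-- The signed count ∑_π sgn π over all star labellings, graded by exponent, is the polynomial
-- P = ∑_π sgn π ∏_e x_e ^ w_π(e).  Expanding one Vandermonde determinant per vertex shows that
-- P = ∏_v det (x_e ^ j) (e at v, j < deg v), so P vanishes at any point where two edges sharing
-- a vertex take the same value, and all monomials of P have degree ∑_v (0 + 1 + ⋯ + (deg v − 1)).
-- If the coefficient c_t of x^t is nonzero, give every edge e a list of t(e) + 1 distinct colours
-- a_e and integer weights λ_e annihilating 1, x, …, x^(t(e)−1) on a_e but not x^(t(e)).  Summing
-- P against ∏_e λ_e over all choices of colours kills every monomial except x^t, since any other
-- monomial of the same degree has some exponent below t(e); the sum is c_t ∏_e λ_e(x^t(e)) ≠ 0,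
-- so P is nonzero at some choice of colours, which is then a proper colouring from the lists.
-- Finally the signed count over Π(𝒲) is the sum of c_w over the distinct w among w_1, …, w_k.

module Submission where

open import Defs
open import Algebra.Bundles using (CommutativeMonoid)
open import Algebra.Core using (Op₂)
open import Algebra.Structures using (IsCommutativeMonoid)
open import Data.Bool using (true; false; if_then_else_)
open import Data.Empty using (⊥-elim)
open import Data.Fin using (Fin; zero; suc; inject≤)
import Data.Fin.Properties as FinP
open import Data.Integer using (ℤ; +_; -[1+_]; -1ℤ; _+_; _*_; -_; _-_; _^_)
import Data.Integer.Properties as ZP
import Algebra.Properties.CommutativeSemigroup ZP.+-commutativeSemigroup as ℤ+
open import Data.Integer.Tactic.RingSolver using (solve-∀)
open import Data.List using (List; []; _∷_; [_]; _++_; map; concatMap; filter; foldr; zipWith; length; lookup; allFin; tabulate; upTo)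
open import Data.List.Membership.Propositional using (_∈_; find)
import Data.List.Membership.Propositional.Properties as ∈P
import Data.List.Properties as ListP
open import Data.List.Relation.Binary.Permutation.Propositional
  using (_↭_; ↭-refl; ↭-sym; ↭-trans; ↭-reflexive; ↭-prep; ↭-swap; ↭⇒↭ₛ)
open import Data.List.Relation.Binary.Permutation.Propositional.Properties using (All-resp-↭; ↭-length; filter-↭)
open import Data.List.Relation.Binary.Permutation.Setoid.Properties using (foldr-commMonoid)
open import Data.List.Relation.Unary.All as All using (All; []; _∷_)
import Data.List.Relation.Unary.All.Properties as AllP
open import Data.List.Relation.Unary.AllPairs using ([]; _∷_)
open import Data.List.Relation.Unary.Any using (here; there)
open import Data.List.Relation.Unary.Unique.Propositional using (Unique)
import Data.List.Relation.Unary.Unique.DecPropositional as UniqueDec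
import Data.List.Relation.Unary.Unique.Propositional.Properties as UniqueP
open import Data.Nat as ℕ using (ℕ; zero; suc; _<_; _≤_; s≤s; z≤n; _<?_)
open import Data.Nat.ListAction using (sum)
open import Data.Nat.ListAction.Properties using (sum-↭)
import Data.Nat.Properties as NP
import Data.Nat.Tactic.RingSolver as ℕSolver
open import Data.List.Membership.DecPropositional NP._≟_ using () renaming (_∈?_ to _∈ℕ?_)
open import Data.Product using (∃-syntax; _×_; _,_; proj₁; proj₂)
open import Data.Sum using (inj₁; inj₂; [_,_]′)
open import Data.Vec.Functional using (removeAt)
open import Function using (_∘_; id)
open import Relation.Binary.Definitions using (tri<; tri≈; tri>)
import Relation.Binary.PropositionalEquality as ≡
open import Relation.Binary.PropositionalEquality using (_≡_; _≢_; refl; sym; trans; cong; cong₂; module ≡-Reasoning)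
open import Relation.Nullary using (Dec; yes; no; ¬_; does; ¬?)
open import Relation.Unary using (Decidable)

module CommutativeMonoidSums {A : Set} {_∙_ : Op₂ A} {ε : A} (isCM : IsCommutativeMonoid _≡_ _∙_ ε) where

  open IsCommutativeMonoid isCM using (assoc; comm; identityˡ; identityʳ)

  private
    M : CommutativeMonoid _ _
    M = record { isCommutativeMonoid = isCM }

  open import Algebra.Properties.CommutativeMonoid.Sum M public
    using () renaming (sum to big; sum-cong-≗ to big-cong; ∑-distrib-+ to big-distrib;
                       ∑-comm to big-comm; sum-replicate-zero to big-ε; sum-remove to big-remove)

  open import Algebra.Properties.CommutativeSemigroup (CommutativeMonoid.commutativeSemigroup M)
    using (interchange; x∙yz≈y∙xz)

  big-support₁ : ∀ {n} (f : Fin n → A) u → (∀ v → v ≢ u → f v ≡ ε) → big f ≡ f u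
  big-support₁ {suc n} f zero f≡ε = trans (cong (f zero ∙_) (trans (big-cong (λ v → f≡ε (suc v) λ ())) (big-ε n))) (identityʳ _)
  big-support₁ {suc n} f (suc u) f≡ε = trans (cong (_∙ big (λ v → f (suc v))) (f≡ε zero λ ()))
    (trans (identityˡ _) (big-support₁ (λ v → f (suc v)) u (λ v v≢u → f≡ε (suc v) (v≢u ∘ FinP.suc-injective))))

  big-support₂ : ∀ {n} (f : Fin n → A) u u' → u ≢ u' → (∀ v → v ≢ u → v ≢ u' → f v ≡ ε) → big f ≡ f u ∙ f u'
  big-support₂ {suc n} f zero zero u≢u' _ = ⊥-elim (u≢u' refl)
  big-support₂ {suc n} f zero (suc u') _ f≡ε =
    cong (f zero ∙_) (big-support₁ (λ v → f (suc v)) u' (λ v v≢u' → f≡ε (suc v) (λ ()) (v≢u' ∘ FinP.suc-injective)))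
  big-support₂ {suc n} f (suc u) zero _ f≡ε =
    trans (cong (f zero ∙_) (big-support₁ (λ v → f (suc v)) u (λ v v≢u → f≡ε (suc v) (v≢u ∘ FinP.suc-injective) (λ ()))))
          (comm _ _)
  big-support₂ {suc n} f (suc u) (suc u') u≢u' f≡ε = trans (cong (_∙ big (λ v → f (suc v))) (f≡ε zero (λ ()) (λ ())))
    (trans (identityˡ _) (big-support₂ (λ v → f (suc v)) u u' (u≢u' ∘ cong suc)
      (λ v v≢u v≢u' → f≡ε (suc v) (v≢u ∘ FinP.suc-injective) (v≢u' ∘ FinP.suc-injective))))

  big-extract : ∀ {n} (f g : Fin n → A) u → (∀ v → v ≢ u → f v ≡ g v) → g u ≡ ε → big f ≡ f u ∙ big g
  big-extract {suc n} f g zero f≡g gu≡ε = cong (f zero ∙_)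
    (trans (big-cong (λ v → f≡g (suc v) (λ ()))) (sym (trans (cong (_∙ big (λ v → g (suc v))) gu≡ε) (identityˡ _))))
  big-extract {suc n} f g (suc u) f≡g gu≡ε =
    trans (cong₂ _∙_ (f≡g zero (λ ()))
                     (big-extract (λ v → f (suc v)) (λ v → g (suc v)) u (λ v v≢u → f≡g (suc v) (v≢u ∘ FinP.suc-injective)) gu≡ε))
          (x∙yz≈y∙xz _ _ _)

  foldr-tabulate : ∀ {n} (f : Fin n → A) → foldr _∙_ ε (tabulate f) ≡ big f
  foldr-tabulate {zero} f = refl
  foldr-tabulate {suc n} f = cong (f zero ∙_) (foldr-tabulate (λ v → f (suc v)))

  ∑ˡ : {X : Set} → List X → (X → A) → A
  ∑ˡ xs f = foldr _∙_ ε (map f xs)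

  ∑ˡ-allFin : ∀ n (f : Fin n → A) → ∑ˡ (allFin n) f ≡ big f
  ∑ˡ-allFin n f = trans (cong (foldr _∙_ ε) (ListP.map-tabulate id f)) (foldr-tabulate f)

  ∑ˡ-++ : {X : Set} (xs ys : List X) (f : X → A) → ∑ˡ (xs ++ ys) f ≡ ∑ˡ xs f ∙ ∑ˡ ys f
  ∑ˡ-++ [] ys f = sym (identityˡ _)
  ∑ˡ-++ (x ∷ xs) ys f = trans (cong (f x ∙_) (∑ˡ-++ xs ys f)) (sym (assoc _ _ _))

  ∑ˡ-map : {X Y : Set} (g : X → Y) (xs : List X) (f : Y → A) → ∑ˡ (map g xs) f ≡ ∑ˡ xs (λ x → f (g x))
  ∑ˡ-map g xs f = cong (foldr _∙_ ε) (sym (ListP.map-∘ xs))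

  ∑ˡ-concatMap : {X Y : Set} (g : X → List Y) (xs : List X) (f : Y → A) → ∑ˡ (concatMap g xs) f ≡ ∑ˡ xs (λ x → ∑ˡ (g x) f)
  ∑ˡ-concatMap g [] f = refl
  ∑ˡ-concatMap g (x ∷ xs) f = trans (∑ˡ-++ (g x) (concatMap g xs) f) (cong (∑ˡ (g x) f ∙_) (∑ˡ-concatMap g xs f))

  ∑ˡ-cong : {X : Set} (xs : List X) {f g : X → A} → (∀ x → x ∈ xs → f x ≡ g x) → ∑ˡ xs f ≡ ∑ˡ xs g
  ∑ˡ-cong [] _ = refl
  ∑ˡ-cong (x ∷ xs) f≡g = cong₂ _∙_ (f≡g x (here refl)) (∑ˡ-cong xs (λ y y∈ → f≡g y (there y∈)))

  ∑ˡ-ε : {X : Set} (xs : List X) → ∑ˡ xs (λ _ → ε) ≡ ε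
  ∑ˡ-ε [] = refl
  ∑ˡ-ε (x ∷ xs) = trans (identityˡ _) (∑ˡ-ε xs)

  ∑ˡ-distrib : {X : Set} (xs : List X) (f g : X → A) → ∑ˡ xs (λ x → f x ∙ g x) ≡ ∑ˡ xs f ∙ ∑ˡ xs g
  ∑ˡ-distrib [] f g = sym (identityˡ ε)
  ∑ˡ-distrib (x ∷ xs) f g = trans (cong ((f x ∙ g x) ∙_) (∑ˡ-distrib xs f g)) (interchange _ _ _ _)

  ∑ˡ-comm : {X Y : Set} (xs : List X) (ys : List Y) (f : X → Y → A) →
    ∑ˡ xs (λ x → ∑ˡ ys (f x)) ≡ ∑ˡ ys (λ y → ∑ˡ xs (λ x → f x y))
  ∑ˡ-comm [] ys f = sym (∑ˡ-ε ys)
  ∑ˡ-comm (x ∷ xs) ys f = trans (cong (∑ˡ ys (f x) ∙_) (∑ˡ-comm xs ys f)) (sym (∑ˡ-distrib ys _ _))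

  foldr-↭ : ∀ {xs ys} → xs ↭ ys → foldr _∙_ ε xs ≡ foldr _∙_ ε ys
  foldr-↭ xs↭ys = foldr-commMonoid (≡.setoid A) isCM (↭⇒↭ₛ xs↭ys)

  ∑ˡ-filter : {X : Set} {P : X → Set} (P? : Decidable P) (xs : List X) (f : X → A) →
    ∑ˡ (filter P? xs) f ≡ ∑ˡ xs (λ x → if does (P? x) then f x else ε)
  ∑ˡ-filter P? [] f = refl
  ∑ˡ-filter P? (x ∷ xs) f with does (P? x)
  ... | true = cong (f x ∙_) (∑ˡ-filter P? xs f)
  ... | false = trans (∑ˡ-filter P? xs f) (sym (identityˡ _))

module ∑ℤ = CommutativeMonoidSums ZP.+-0-isCommutativeMonoid
module ∏ℤ = CommutativeMonoidSums ZP.*-1-isCommutativeMonoid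
module ∑ℕ = CommutativeMonoidSums NP.+-0-isCommutativeMonoid

open ∑ℤ using (∑ˡ)

∑ : ∀ {n} → (Fin n → ℤ) → ℤ
∑ = ∑ℤ.big

∏ : ∀ {n} → (Fin n → ℤ) → ℤ
∏ = ∏ℤ.big

∑-*ˡ : ∀ {n} (c : ℤ) (f : Fin n → ℤ) → ∑ (λ i → c * f i) ≡ c * ∑ f
∑-*ˡ {zero} c f = sym (ZP.*-zeroʳ c)
∑-*ˡ {suc n} c f = trans (cong (_+_ (c * f zero)) (∑-*ˡ c (λ i → f (suc i)))) (sym (ZP.*-distribˡ-+ c _ _))

∑ˡ-*ˡ : {X : Set} (xs : List X) (c : ℤ) (f : X → ℤ) → ∑ˡ xs (λ x → c * f x) ≡ c * ∑ˡ xs f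
∑ˡ-*ˡ [] c f = sym (ZP.*-zeroʳ c)
∑ˡ-*ˡ (x ∷ xs) c f = trans (cong (_+_ (c * f x)) (∑ˡ-*ˡ xs c f)) (sym (ZP.*-distribˡ-+ c _ _))

∑ˡ-*ʳ : {X : Set} (xs : List X) (c : ℤ) (f : X → ℤ) → ∑ˡ xs (λ x → f x * c) ≡ ∑ˡ xs f * c
∑ˡ-*ʳ xs c f = trans (∑ℤ.∑ˡ-cong xs (λ x _ → ZP.*-comm (f x) c)) (trans (∑ˡ-*ˡ xs c f) (ZP.*-comm c _))

∑ˡ-neg : {X : Set} (xs : List X) (f : X → ℤ) → ∑ˡ xs (λ x → - f x) ≡ - ∑ˡ xs f
∑ˡ-neg [] f = refl
∑ˡ-neg (x ∷ xs) f = trans (cong (_+_ (- f x)) (∑ˡ-neg xs f)) (sym (ZP.neg-distrib-+ (f x) _))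

∑ˡ-≢0⇒∃ : {X : Set} (xs : List X) (f : X → ℤ) → ∑ˡ xs f ≢ + 0 → ∃[ x ] (x ∈ xs × f x ≢ + 0)
∑ˡ-≢0⇒∃ [] f ∑≢0 = ⊥-elim (∑≢0 refl)
∑ˡ-≢0⇒∃ (x ∷ xs) f ∑≢0 with f x ZP.≟ + 0
... | no fx≢0 = x , here refl , fx≢0
... | yes fx≡0 with ∑ˡ-≢0⇒∃ xs f (λ ∑≡0 → ∑≢0 (cong₂ _+_ fx≡0 ∑≡0))
...   | y , y∈ , fy≢0 = y , there y∈ , fy≢0

∏-≢0 : ∀ {n} (f : Fin n → ℤ) → (∀ i → f i ≢ + 0) → ∏ f ≢ + 0
∏-≢0 {zero} f _ ()
∏-≢0 {suc n} f f≢0 ∏≡0 with ZP.i*j≡0⇒i≡0∨j≡0 (f zero) ∏≡0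
... | inj₁ f0≡0 = f≢0 zero f0≡0
... | inj₂ ∏≡0′ = ∏-≢0 (λ i → f (suc i)) (λ i → f≢0 (suc i)) ∏≡0′

∏-≡0 : ∀ {n} (f : Fin n → ℤ) i → f i ≡ + 0 → ∏ f ≡ + 0
∏-≡0 f zero fi≡0 = trans (cong (_* ∏ (λ j → f (suc j))) fi≡0) (ZP.*-zeroˡ (∏ (λ j → f (suc j))))
∏-≡0 f (suc i) fi≡0 = trans (cong (f zero *_) (∏-≡0 (λ j → f (suc j)) i fi≡0)) (ZP.*-zeroʳ (f zero))

∑ˡ-choices-∏ : ∀ n {A : Fin n → Set} (S : (i : Fin n) → List (A i)) (F : (i : Fin n) → A i → ℤ) →
  ∑ˡ (choices n S) (λ φ → ∏ (λ i → F i (φ i))) ≡ ∏ (λ i → ∑ˡ (S i) (F i))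
∑ˡ-choices-∏ zero S F = refl
∑ˡ-choices-∏ (suc n) S F = begin
    ∑ˡ (choices (suc n) S) (λ φ → ∏ (λ i → F i (φ i)))
  ≡⟨ ∑ℤ.∑ˡ-concatMap _ (S zero) _ ⟩
    ∑ˡ (S zero) (λ a → ∑ˡ (map _ (choices n S′)) (λ φ → ∏ (λ i → F i (φ i))))
  ≡⟨ ∑ℤ.∑ˡ-cong (S zero) (λ a _ → ∑ℤ.∑ˡ-map _ (choices n S′) _) ⟩
    ∑ˡ (S zero) (λ a → ∑ˡ (choices n S′) (λ φ → F zero a * ∏ (λ i → F (suc i) (φ i))))
  ≡⟨ ∑ℤ.∑ˡ-cong (S zero) (λ a _ → ∑ˡ-*ˡ (choices n S′) (F zero a) _) ⟩
    ∑ˡ (S zero) (λ a → F zero a * ∑ˡ (choices n S′) (λ φ → ∏ (λ i → F (suc i) (φ i))))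
  ≡⟨ ∑ℤ.∑ˡ-cong (S zero) (λ a _ → cong (F zero a *_) (∑ˡ-choices-∏ n S′ (λ i → F (suc i)))) ⟩
    ∑ˡ (S zero) (λ a → F zero a * ∏ (λ i → ∑ˡ (S′ i) (F (suc i))))
  ≡⟨ ∑ˡ-*ʳ (S zero) _ (F zero) ⟩
    ∑ˡ (S zero) (F zero) * ∏ (λ i → ∑ˡ (S′ i) (F (suc i))) ∎
  where
  open ≡-Reasoning
  S′ = λ i → S (suc i)

∈-choices⁻ : ∀ n {A : Fin n → Set} (S : (i : Fin n) → List (A i)) {φ} → φ ∈ choices n S → ∀ i → φ i ∈ S i
∈-choices⁻ (suc n) S φ∈ i with a , a∈ , φ∈a∷ ← find (∈P.∈-concatMap⁻ _ {xs = S zero} φ∈)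
                         with ψ , ψ∈ , refl ← ∈P.∈-map⁻ _ φ∈a∷
                         with i
... | zero = a∈
... | suc i′ = ∈-choices⁻ n (λ j → S (suc j)) ψ∈ i′

∑ℕ-mono-≤ : ∀ {n} {f g : Fin n → ℕ} → (∀ i → f i ≤ g i) → ∑ℕ.big f ≤ ∑ℕ.big g
∑ℕ-mono-≤ {zero} _ = z≤n
∑ℕ-mono-≤ {suc n} f≤g = NP.+-mono-≤ (f≤g zero) (∑ℕ-mono-≤ (λ i → f≤g (suc i)))

∑ℕ-≡⇒≡ : ∀ {n} {f g : Fin n → ℕ} → (∀ i → f i ≤ g i) → ∑ℕ.big f ≡ ∑ℕ.big g → ∀ i → f i ≡ g i
∑ℕ-≡⇒≡ {suc n} {f} {g} f≤g ∑f≡∑g i with f zero NP.≟ g zero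
... | no f0≢g0 =
  ⊥-elim (NP.<-irrefl ∑f≡∑g (NP.+-mono-<-≤ (NP.≤∧≢⇒< (f≤g zero) f0≢g0) (∑ℕ-mono-≤ (λ j → f≤g (suc j)))))
... | yes f0≡g0 with i
...   | zero = f0≡g0
...   | suc j = ∑ℕ-≡⇒≡ (λ j → f≤g (suc j)) (NP.+-cancelˡ-≡ (f zero) _ _ (trans ∑f≡∑g (cong (ℕ._+ _) (sym f0≡g0)))) j

∑ℕ-≡⇒∃< : ∀ {n} (f g : Fin n → ℕ) → ∑ℕ.big f ≡ ∑ℕ.big g → ¬ (∀ i → f i ≡ g i) → ∃[ i ] f i < g i
∑ℕ-≡⇒∃< f g ∑f≡∑g f≢g with FinP.any? (λ i → f i <? g i)
... | yes f<g = f<g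
... | no f≮g = ⊥-elim (f≢g (λ i → sym (∑ℕ-≡⇒≡ (λ j → NP.≮⇒≥ (λ fj<gj → f≮g (j , fj<gj))) (sym ∑f≡∑g) i)))

≡-if-does : ∀ {P : Set} (P? : Dec P) {x y : ℤ} → (P → x ≡ y) → (¬ P → x ≡ + 0) → x ≡ (if does P? then y else + 0)
≡-if-does (yes p) x≡y _ = x≡y p
≡-if-does (no ¬p) _ x≡0 = x≡0 ¬p

lookup-injective : {A : Set} (xs : List A) → Unique xs → ∀ i j → lookup xs i ≡ lookup xs j → i ≡ j
lookup-injective (x ∷ xs) _ zero zero _ = refl
lookup-injective (x ∷ xs) (x∉xs ∷ _) zero (suc j) x≡ = ⊥-elim (All.lookup x∉xs (∈P.∈-lookup j) x≡)
lookup-injective (x ∷ xs) (x∉xs ∷ _) (suc i) zero ≡x = ⊥-elim (All.lookup x∉xs (∈P.∈-lookup i) (sym ≡x))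
lookup-injective (x ∷ xs) (_ ∷ uxs) (suc i) (suc j) eq = cong suc (lookup-injective xs uxs i j eq)

moment : ∀ {n} (a w : Fin n → ℤ) → ℕ → ℤ
moment a w j = ∑ (λ i → a i ^ j * w i)

DetectsDegree : ∀ t {n} (a w : Fin n → ℤ) → Set
DetectsDegree t a w = (∀ j → j < t → moment a w j ≡ + 0) × moment a w t ≢ + 0

powDiffQuot : ℕ → ℤ → ℤ → ℤ
powDiffQuot zero x y = + 0
powDiffQuot (suc j) x y = x ^ j + y * powDiffQuot j x y

pow-diff : ∀ j x y → x ^ j - y ^ j ≡ (x - y) * powDiffQuot j x y
pow-diff zero x y = trans (ZP.+-inverseʳ (+ 1)) (sym (ZP.*-zeroʳ (x - y)))
pow-diff (suc j) x y = begin
    x * x ^ j - y * y ^ j                         ≡⟨ split x y (x ^ j) (y ^ j) ⟩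
    (x - y) * x ^ j + y * (x ^ j - y ^ j)         ≡⟨ cong (λ z → (x - y) * x ^ j + y * z) (pow-diff j x y) ⟩
    (x - y) * x ^ j + y * ((x - y) * q)           ≡⟨ factor x y (x ^ j) q ⟩
    (x - y) * (x ^ j + y * q)                     ∎
  where
  open ≡-Reasoning
  q = powDiffQuot j x y
  split : ∀ x y X Y → x * X - y * Y ≡ (x - y) * X + y * (X - Y)
  split = solve-∀
  factor : ∀ x y X q → (x - y) * X + y * ((x - y) * q) ≡ (x - y) * (X + y * q)
  factor = solve-∀

∑-*-sub : ∀ {n} (b : ℤ) (x c : Fin n → ℤ) → b * (- ∑ c) + ∑ (λ i → x i * c i) ≡ ∑ (λ i → (x i - b) * c i)
∑-*-sub b x c = begin
    b * (- ∑ c) + ∑ (λ i → x i * c i)           ≡⟨ swapNeg b (∑ c) _ ⟩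
    ∑ (λ i → x i * c i) + (- b) * ∑ c           ≡⟨ cong (_+_ (∑ (λ i → x i * c i))) (sym (∑-*ˡ (- b) c)) ⟩
    ∑ (λ i → x i * c i) + ∑ (λ i → - b * c i)   ≡⟨ sym (∑ℤ.big-distrib (λ i → x i * c i) (λ i → - b * c i)) ⟩
    ∑ (λ i → x i * c i + - b * c i)             ≡⟨ ∑ℤ.big-cong (λ i → collect (x i) b (c i)) ⟩
    ∑ (λ i → (x i - b) * c i)                   ∎
  where
  open ≡-Reasoning
  swapNeg : ∀ b S T → b * (- S) + T ≡ T + (- b) * S
  swapNeg = solve-∀
  collect : ∀ X b c → X * c + - b * c ≡ (X - b) * c
  collect = solve-∀

-- If w detects degree t on the nodes a ∘ suc, then `extended` is the functional
--   p ↦ ∏ₖ (a (suc k) − a 0) · ∑ᵢ wᵢ (p (a (suc i)) − p (a 0)) / (a (suc i) − a 0),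
-- which detects degree t + 1 on all nodes because the divided difference lowers degrees by one.
module AddNode {t} (a : Fin (suc (suc t)) → ℤ) (w : Fin (suc t) → ℤ) where

  a′ : Fin (suc t) → ℤ
  a′ i = a (suc i)

  d : Fin (suc t) → ℤ
  d i = a′ i - a zero

  c : Fin (suc t) → ℤ
  c i = w i * ∏ (removeAt d i)

  extended : Fin (suc (suc t)) → ℤ
  extended zero = - ∑ c
  extended (suc i) = c i

  quotMoment : ℕ → ℤ
  quotMoment j = ∑ (λ i → powDiffQuot j (a′ i) (a zero) * w i)

  moment-extended : ∀ j → moment a extended j ≡ ∏ d * quotMoment j
  moment-extended j = begin
      a zero ^ j * (- ∑ c) + ∑ (λ i → a′ i ^ j * c i)
    ≡⟨ ∑-*-sub (a zero ^ j) (λ i → a′ i ^ j) c ⟩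
      ∑ (λ i → (a′ i ^ j - a zero ^ j) * c i)
    ≡⟨ ∑ℤ.big-cong (λ i → cong (_* c i) (pow-diff j (a′ i) (a zero))) ⟩
      ∑ (λ i → (d i * q i) * (w i * ∏ (removeAt d i)))
    ≡⟨ ∑ℤ.big-cong (λ i → regroup (d i) (q i) (w i) (∏ (removeAt d i))) ⟩
      ∑ (λ i → (d i * ∏ (removeAt d i)) * (q i * w i))
    ≡⟨ ∑ℤ.big-cong (λ i → cong (_* (q i * w i)) (sym (∏ℤ.big-remove {i = i} d))) ⟩
      ∑ (λ i → ∏ d * (q i * w i))
    ≡⟨ ∑-*ˡ (∏ d) (λ i → q i * w i) ⟩
      ∏ d * quotMoment j ∎
    where
    open ≡-Reasoning
    q : Fin (suc t) → ℤ
    q i = powDiffQuot j (a′ i) (a zero)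
    regroup : ∀ d q w r → (d * q) * (w * r) ≡ (d * r) * (q * w)
    regroup = solve-∀

  quotMoment-suc : ∀ j → quotMoment (suc j) ≡ moment a′ w j + a zero * quotMoment j
  quotMoment-suc j = begin
      ∑ (λ i → (a′ i ^ j + a zero * q i) * w i)
    ≡⟨ ∑ℤ.big-cong (λ i → expand (a′ i ^ j) (a zero) (q i) (w i)) ⟩
      ∑ (λ i → a′ i ^ j * w i + a zero * (q i * w i))
    ≡⟨ ∑ℤ.big-distrib (λ i → a′ i ^ j * w i) (λ i → a zero * (q i * w i)) ⟩
      moment a′ w j + ∑ (λ i → a zero * (q i * w i))
    ≡⟨ cong (_+_ (moment a′ w j)) (∑-*ˡ (a zero) (λ i → q i * w i)) ⟩
      moment a′ w j + a zero * quotMoment j ∎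
    where
    open ≡-Reasoning
    q : Fin (suc t) → ℤ
    q i = powDiffQuot j (a′ i) (a zero)
    expand : ∀ x b q w → (x + b * q) * w ≡ x * w + b * (q * w)
    expand = solve-∀

  module _ (low : ∀ j → j < t → moment a′ w j ≡ + 0) where

    quotMoment-low : ∀ j → j ≤ t → quotMoment j ≡ + 0
    quotMoment-low zero _ = trans (∑ℤ.big-cong (λ i → ZP.*-zeroˡ (w i))) (∑ℤ.big-ε (suc t))
    quotMoment-low (suc j) j<t = begin
        quotMoment (suc j)                       ≡⟨ quotMoment-suc j ⟩
        moment a′ w j + a zero * quotMoment j    ≡⟨ cong₂ (λ u v → u + a zero * v) (low j j<t) (quotMoment-low j (NP.<⇒≤ j<t)) ⟩
        + 0 + a zero * + 0                       ≡⟨ cong (_+_ (+ 0)) (ZP.*-zeroʳ (a zero)) ⟩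
        + 0                                      ∎
      where open ≡-Reasoning

    quotMoment-top : quotMoment (suc t) ≡ moment a′ w t
    quotMoment-top = begin
        quotMoment (suc t)                       ≡⟨ quotMoment-suc t ⟩
        moment a′ w t + a zero * quotMoment t    ≡⟨ cong (λ q → moment a′ w t + a zero * q) (quotMoment-low t NP.≤-refl) ⟩
        moment a′ w t + a zero * + 0             ≡⟨ cong (_+_ (moment a′ w t)) (ZP.*-zeroʳ (a zero)) ⟩
        moment a′ w t + + 0                      ≡⟨ ZP.+-identityʳ (moment a′ w t) ⟩
        moment a′ w t                            ∎
      where open ≡-Reasoning

detectingWeights : ∀ t (a : Fin (suc t) → ℤ) → (∀ i j → a i ≡ a j → i ≡ j) → ∃[ w ] DetectsDegree t a w
detectingWeights zero a _ = (λ _ → + 1) , (λ _ ()) , (λ ())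
detectingWeights (suc t) a a-inj with detectingWeights t (a ∘ suc) (λ i j eq → FinP.suc-injective (a-inj _ _ eq))
... | w , low , top = extended , low′ , top′
  where
  open AddNode a w
  ∏d≢0 : ∏ d ≢ + 0
  ∏d≢0 = ∏-≢0 d (λ i di≡0 → FinP.0≢1+n (a-inj zero (suc i) (sym (ZP.i-j≡0⇒i≡j (a′ i) (a zero) di≡0))))
  low′ : ∀ j → j < suc t → moment a extended j ≡ + 0
  low′ j (s≤s j≤t) = trans (moment-extended j) (trans (cong (∏ d *_) (quotMoment-low low j j≤t)) (ZP.*-zeroʳ (∏ d)))
  top′ : moment a extended (suc t) ≢ + 0
  top′ eq = [ ∏d≢0 , (λ q≡0 → top (trans (sym (quotMoment-top low)) q≡0)) ]′
              (ZP.i*j≡0⇒i≡0∨j≡0 (∏ d) (trans (sym (moment-extended (suc t))) eq))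

swapAt : {A : Set} → ℕ → List A → List A
swapAt zero (x ∷ y ∷ r) = y ∷ x ∷ r
swapAt (suc i) (x ∷ r) = x ∷ swapAt i r
swapAt _ r = r

swapAt-↭ : {A : Set} (i : ℕ) (xs : List A) → swapAt i xs ↭ xs
swapAt-↭ zero [] = ↭-refl
swapAt-↭ zero (x ∷ []) = ↭-refl
swapAt-↭ zero (x ∷ y ∷ r) = ↭-swap y x ↭-refl
swapAt-↭ (suc i) [] = ↭-refl
swapAt-↭ (suc i) (x ∷ r) = ↭-prep x (swapAt-↭ i r)

swapAt-involutive : {A : Set} (i : ℕ) (xs : List A) → swapAt i (swapAt i xs) ≡ xs
swapAt-involutive zero [] = refl
swapAt-involutive zero (x ∷ []) = refl
swapAt-involutive zero (x ∷ y ∷ r) = refl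
swapAt-involutive (suc i) [] = refl
swapAt-involutive (suc i) (x ∷ r) = cong (x ∷_) (swapAt-involutive i r)

Unique-swapAt : {A : Set} (i : ℕ) {xs : List A} → Unique xs → Unique (swapAt i xs)
Unique-swapAt zero {[]} u = u
Unique-swapAt zero {x ∷ []} u = u
Unique-swapAt zero {x ∷ y ∷ r} ((x≢y ∷ x∉r) ∷ y∉r ∷ ur) = ((x≢y ∘ sym) ∷ y∉r) ∷ x∉r ∷ ur
Unique-swapAt (suc i) {[]} u = u
Unique-swapAt (suc i) {x ∷ r} (x∉r ∷ ur) = All-resp-↭ (↭-sym (swapAt-↭ i r)) x∉r ∷ Unique-swapAt i ur

swapAt-++ : {A : Set} (as : List A) (x y : A) (r : List A) → swapAt (length as) (as ++ x ∷ y ∷ r) ≡ as ++ y ∷ x ∷ r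
swapAt-++ [] x y r = refl
swapAt-++ (a ∷ as) x y r = cong (a ∷_) (swapAt-++ as x y r)

swapAt-zipWith : {A B C : Set} (f : A → B → C) (i : ℕ) (xs : List A) (ys : List B) → length xs ≡ length ys →
  zipWith f (swapAt i xs) (swapAt i ys) ≡ swapAt i (zipWith f xs ys)
swapAt-zipWith f zero [] [] _ = refl
swapAt-zipWith f zero (x ∷ []) (y ∷ []) _ = refl
swapAt-zipWith f zero (x ∷ x′ ∷ xs) (y ∷ y′ ∷ ys) _ = refl
swapAt-zipWith f (suc i) [] [] _ = refl
swapAt-zipWith f (suc i) (x ∷ xs) (y ∷ ys) eq = cong (f x y ∷_) (swapAt-zipWith f i xs ys (NP.suc-injective eq))
swapAt-zipWith f zero [] (_ ∷ _) ()
swapAt-zipWith f zero (_ ∷ _) [] ()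
swapAt-zipWith f zero (x ∷ []) (y ∷ _ ∷ _) ()
swapAt-zipWith f zero (x ∷ _ ∷ _) (y ∷ []) ()
swapAt-zipWith f (suc i) [] (_ ∷ _) ()
swapAt-zipWith f (suc i) (_ ∷ _) [] ()

sign-∷ : ∀ x xs → sign (x ∷ xs) ≡ -1ℤ ^ length (filter (_<? x) xs) * sign xs
sign-∷ x xs = ZP.^-distribˡ-+-* -1ℤ (length (filter (_<? x) xs)) (inversions xs)

sign-swap₀ : ∀ {x y} r → x < y → sign (y ∷ x ∷ r) ≡ - sign (x ∷ y ∷ r)
sign-swap₀ {x} {y} r x<y = trans (cong (-1ℤ ^_) inversions-swap₀) (ZP.-1*i≡-i (sign (x ∷ y ∷ r)))
  where
  below : ℕ → ℕ
  below z = length (filter (_<? z) r)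
  inversions-swap₀ : inversions (y ∷ x ∷ r) ≡ suc (inversions (x ∷ y ∷ r))
  inversions-swap₀
    rewrite ListP.filter-accept (_<? y) {x} {r} x<y | ListP.filter-reject (_<? x) {y} {r} (NP.<⇒≯ x<y)
    = cong suc (shuffle (below y) (below x) (inversions r))
    where
    shuffle : ∀ a b c → a ℕ.+ (b ℕ.+ c) ≡ b ℕ.+ (a ℕ.+ c)
    shuffle = ℕSolver.solve-∀

sign-swapAt : ∀ i (σ : List ℕ) → Unique σ → suc i < length σ → sign (swapAt i σ) ≡ - sign σ
sign-swapAt zero (x ∷ []) _ (s≤s ())
sign-swapAt zero (x ∷ y ∷ r) ((x≢y ∷ _) ∷ _) _ with NP.<-cmp x y
... | tri< x<y _ _ = sign-swap₀ r x<y
... | tri≈ _ x≡y _ = ⊥-elim (x≢y x≡y)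
... | tri> _ _ y<x = trans (sym (ZP.neg-involutive _)) (cong -_ (sym (sign-swap₀ r y<x)))
sign-swapAt (suc i) (x ∷ r) (_ ∷ ur) (s≤s i<r) = begin
    sign (x ∷ swapAt i r)                                     ≡⟨ sign-∷ x (swapAt i r) ⟩
    -1ℤ ^ length (filter (_<? x) (swapAt i r)) * sign (swapAt i r)
      ≡⟨ cong₂ (λ l s → -1ℤ ^ l * s) (↭-length (filter-↭ (_<? x) (swapAt-↭ i r))) (sign-swapAt i r ur i<r) ⟩
    -1ℤ ^ length (filter (_<? x) r) * - sign r            ≡⟨ sym (ZP.neg-distribʳ-* (-1ℤ ^ length (filter (_<? x) r)) (sign r)) ⟩
    - (-1ℤ ^ length (filter (_<? x) r) * sign r)          ≡⟨ cong -_ (sym (sign-∷ x r)) ⟩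
    - sign (x ∷ r)                                            ∎
  where open ≡-Reasoning

leviCivita : List ℕ → ℤ
leviCivita σ = if does (UniqueDec.unique? NP._≟_ σ) then sign σ else + 0

leviCivita-swapAt : ∀ i (σ : List ℕ) → suc i < length σ → leviCivita (swapAt i σ) ≡ - leviCivita σ
leviCivita-swapAt i σ i<σ with UniqueDec.unique? NP._≟_ (swapAt i σ) | UniqueDec.unique? NP._≟_ σ
... | yes _ | yes uσ = sign-swapAt i σ uσ i<σ
... | no _ | no _ = refl
... | yes uσ′ | no ¬uσ = ⊥-elim (¬uσ (≡.subst Unique (swapAt-involutive i σ) (Unique-swapAt i uσ′)))
... | no ¬uσ′ | yes uσ = ⊥-elim (¬uσ′ (Unique-swapAt i uσ))

monomial : List ℤ → List ℕ → ℤ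
monomial y σ = productℤ (zipWith _^_ y σ)

monomial-swapAt : ∀ i (y : List ℤ) (σ : List ℕ) → length y ≡ length σ → monomial (swapAt i y) (swapAt i σ) ≡ monomial y σ
monomial-swapAt i y σ eq = trans (cong productℤ (swapAt-zipWith _^_ i y σ eq)) (∏ℤ.foldr-↭ (swapAt-↭ i _))

∈-tuples⁻ : ∀ k d {σ} → σ ∈ tuples k d → length σ ≡ k × All (_< d) σ
∈-tuples⁻ zero d (here refl) = refl , []
∈-tuples⁻ (suc k) d σ∈ with x , x∈ , σ∈x∷ ← find (∈P.∈-concatMap⁻ (λ x → map (x ∷_) (tuples k d)) {xs = upTo d} σ∈)
                      with τ , τ∈ , refl ← ∈P.∈-map⁻ (x ∷_) σ∈x∷
                      with τ≡k , τ<d ← ∈-tuples⁻ k d τ∈ = cong suc τ≡k , ∈P.∈-upTo⁻ x∈ ∷ τ<d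

∑ˡ-tuples-suc : ∀ k d (G : List ℕ → ℤ) → ∑ˡ (tuples (suc k) d) G ≡ ∑ˡ (upTo d) (λ x → ∑ˡ (tuples k d) (λ r → G (x ∷ r)))
∑ˡ-tuples-suc k d G = trans (∑ℤ.∑ˡ-concatMap (λ x → map (x ∷_) (tuples k d)) (upTo d) G)
  (∑ℤ.∑ˡ-cong (upTo d) (λ x _ → ∑ℤ.∑ˡ-map (x ∷_) (tuples k d) G))

∑ˡ-tuples-swapAt : ∀ k d i (G : List ℕ → ℤ) → ∑ˡ (tuples k d) G ≡ ∑ˡ (tuples k d) (λ σ → G (swapAt i σ))
∑ˡ-tuples-swapAt zero d zero G = refl
∑ˡ-tuples-swapAt zero d (suc i) G = refl
∑ˡ-tuples-swapAt (suc zero) d zero G = trans (∑ˡ-tuples-suc 0 d G) (sym (∑ˡ-tuples-suc 0 d (λ σ → G (swapAt 0 σ))))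
∑ˡ-tuples-swapAt (suc (suc k)) d zero G = begin
    ∑ˡ (tuples (suc (suc k)) d) G
  ≡⟨ ∑ˡ-tuples-suc (suc k) d G ⟩
    ∑ˡ (upTo d) (λ x → ∑ˡ (tuples (suc k) d) (λ r → G (x ∷ r)))
  ≡⟨ ∑ℤ.∑ˡ-cong (upTo d) (λ x _ → ∑ˡ-tuples-suc k d (λ r → G (x ∷ r))) ⟩
    ∑ˡ (upTo d) (λ x → ∑ˡ (upTo d) (λ y → ∑ˡ (tuples k d) (λ r → G (x ∷ y ∷ r))))
  ≡⟨ ∑ℤ.∑ˡ-comm (upTo d) (upTo d) (λ x y → ∑ˡ (tuples k d) (λ r → G (x ∷ y ∷ r))) ⟩
    ∑ˡ (upTo d) (λ y → ∑ˡ (upTo d) (λ x → ∑ˡ (tuples k d) (λ r → G (x ∷ y ∷ r))))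
  ≡⟨ ∑ℤ.∑ˡ-cong (upTo d) (λ y _ → sym (∑ˡ-tuples-suc k d (λ r → G (swapAt 0 (y ∷ r))))) ⟩
    ∑ˡ (upTo d) (λ y → ∑ˡ (tuples (suc k) d) (λ r → G (swapAt 0 (y ∷ r))))
  ≡⟨ sym (∑ˡ-tuples-suc (suc k) d (λ σ → G (swapAt 0 σ))) ⟩
    ∑ˡ (tuples (suc (suc k)) d) (λ σ → G (swapAt 0 σ)) ∎
  where open ≡-Reasoning
∑ˡ-tuples-swapAt (suc k) d (suc i) G = begin
    ∑ˡ (tuples (suc k) d) G
  ≡⟨ ∑ˡ-tuples-suc k d G ⟩
    ∑ˡ (upTo d) (λ x → ∑ˡ (tuples k d) (λ r → G (x ∷ r)))
  ≡⟨ ∑ℤ.∑ˡ-cong (upTo d) (λ x _ → ∑ˡ-tuples-swapAt k d i (λ r → G (x ∷ r))) ⟩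
    ∑ˡ (upTo d) (λ x → ∑ˡ (tuples k d) (λ r → G (x ∷ swapAt i r)))
  ≡⟨ sym (∑ˡ-tuples-suc k d (λ σ → G (swapAt (suc i) σ))) ⟩
    ∑ˡ (tuples (suc k) d) (λ σ → G (swapAt (suc i) σ)) ∎
  where open ≡-Reasoning

-- The Vandermonde determinant det (yᵢ ^ j), summed over all maps σ : {0..d-1} → {0..d-1} rather than
-- permutations, so that swapping two entries of σ permutes the index list.
alternant : ℕ → List ℤ → ℤ
alternant d y = ∑ˡ (tuples d d) (λ σ → leviCivita σ * monomial y σ)

alternant-swapAt : ∀ d i (y : List ℤ) → length y ≡ d → suc i < d → alternant d (swapAt i y) ≡ - alternant d y
alternant-swapAt d i y y≡d i<d = begin
    ∑ˡ (tuples d d) (λ σ → leviCivita σ * monomial (swapAt i y) σ)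
  ≡⟨ ∑ˡ-tuples-swapAt d d i _ ⟩
    ∑ˡ (tuples d d) (λ σ → leviCivita (swapAt i σ) * monomial (swapAt i y) (swapAt i σ))
  ≡⟨ ∑ℤ.∑ˡ-cong (tuples d d) flip ⟩
    ∑ˡ (tuples d d) (λ σ → - (leviCivita σ * monomial y σ))
  ≡⟨ ∑ˡ-neg (tuples d d) _ ⟩
    - alternant d y ∎
  where
  open ≡-Reasoning
  flip : ∀ σ → σ ∈ tuples d d → leviCivita (swapAt i σ) * monomial (swapAt i y) (swapAt i σ) ≡ - (leviCivita σ * monomial y σ)
  flip σ σ∈ = trans (cong₂ _*_ (leviCivita-swapAt i σ (≡.subst (suc i <_) (sym σ≡d) i<d))
                                (monomial-swapAt i y σ (trans y≡d (sym σ≡d))))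
                    (sym (ZP.neg-distribˡ-* (leviCivita σ) (monomial y σ)))
    where
    σ≡d = proj₁ (∈-tuples⁻ d d σ∈)

HasRepeat : {A : Set} → List A → Set
HasRepeat xs = ∃[ as ] ∃[ a ] ∃[ bs ] ∃[ cs ] (xs ≡ as ++ a ∷ bs ++ a ∷ cs)

map-HasRepeat : {A B : Set} (f : A → B) {xs : List A} {x y : A} → x ∈ xs → y ∈ xs → x ≢ y → f x ≡ f y → HasRepeat (map f xs)
map-HasRepeat f (here refl) (here refl) x≢y _ = ⊥-elim (x≢y refl)
map-HasRepeat f (here refl) (there y∈) _ fx≡fy with bs , cs , eq ← ∈P.∈-∃++ (∈P.∈-map⁺ f y∈) =
  [] , _ , bs , cs , cong (_ ∷_) (trans eq (cong (λ z → bs ++ z ∷ cs) (sym fx≡fy)))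
map-HasRepeat f (there x∈) (here refl) _ fx≡fy with bs , cs , eq ← ∈P.∈-∃++ (∈P.∈-map⁺ f x∈) =
  [] , _ , bs , cs , cong (_ ∷_) (trans eq (cong (λ z → bs ++ z ∷ cs) fx≡fy))
map-HasRepeat f {z ∷ _} (there x∈) (there y∈) x≢y fx≡fy with as , a , bs , cs , eq ← map-HasRepeat f x∈ y∈ x≢y fx≡fy =
  f z ∷ as , a , bs , cs , cong (f z ∷_) eq

x≡-x⇒x≡0 : ∀ (x : ℤ) → x ≡ - x → x ≡ + 0
x≡-x⇒x≡0 (+ zero) _ = refl
x≡-x⇒x≡0 (+ suc n) ()
x≡-x⇒x≡0 -[1+ n ] ()

suc-length<length-++ : {A : Set} (as : List A) (x y : A) (r : List A) → suc (length as) < length (as ++ x ∷ y ∷ r)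
suc-length<length-++ [] x y r = s≤s (s≤s z≤n)
suc-length<length-++ (a ∷ as) x y r = s≤s (suc-length<length-++ as x y r)

alternant-repeat : ∀ d (y : List ℤ) → HasRepeat y → length y ≡ d → alternant d y ≡ + 0
alternant-repeat d _ (as , a , bs , cs , refl) = gap as bs
  where
  -- swap the first a rightwards past bs
  gap : ∀ as bs → length (as ++ a ∷ bs ++ a ∷ cs) ≡ d → alternant d (as ++ a ∷ bs ++ a ∷ cs) ≡ + 0
  gap as [] y≡d = x≡-x⇒x≡0 _ (trans (cong (alternant d) (sym (swapAt-++ as a a cs)))
    (alternant-swapAt d (length as) _ y≡d (≡.subst (suc (length as) <_) y≡d (suc-length<length-++ as a a cs))))
  gap as (b ∷ bs) y≡d = begin
      alternant d y                              ≡⟨ sym (ZP.neg-involutive _) ⟩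
      - - alternant d y                          ≡⟨ cong -_ (sym (alternant-swapAt d (length as) y y≡d i<d)) ⟩
      - alternant d (swapAt (length as) y)       ≡⟨ cong (λ z → - alternant d z) swapped ⟩
      - alternant d ((as ++ [ b ]) ++ a ∷ bs ++ a ∷ cs) ≡⟨ cong -_ (gap (as ++ [ b ]) bs y′≡d) ⟩
      + 0                                         ∎
    where
    open ≡-Reasoning
    y = as ++ a ∷ b ∷ bs ++ a ∷ cs
    i<d : suc (length as) < d
    i<d = ≡.subst (suc (length as) <_) y≡d (suc-length<length-++ as a b _)
    swapped : swapAt (length as) y ≡ (as ++ [ b ]) ++ a ∷ bs ++ a ∷ cs
    swapped = trans (swapAt-++ as a b _) (sym (ListP.++-assoc as [ b ] _))
    y′≡d : length ((as ++ [ b ]) ++ a ∷ bs ++ a ∷ cs) ≡ d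
    y′≡d = trans (cong length (sym swapped)) (trans (↭-length (swapAt-↭ (length as) y)) y≡d)

triangular : ℕ → ℕ
triangular zero = 0
triangular (suc d) = d ℕ.+ triangular d

zipWith-snd : {A B : Set} (xs : List A) (ys : List B) → length xs ≡ length ys → zipWith (λ _ y → y) xs ys ≡ ys
zipWith-snd [] [] _ = refl
zipWith-snd (x ∷ xs) (y ∷ ys) eq = cong (y ∷_) (zipWith-snd xs ys (NP.suc-injective eq))

without : ℕ → List ℕ → List ℕ
without d = filter (λ x → ¬? (x NP.≟ d))

All<-without : ∀ d (σ : List ℕ) → All (_< suc d) σ → All (_< d) (without d σ)
All<-without d σ σ<1+d = All.zipWith (λ (x<1+d , x≢d) → NP.≤∧≢⇒< (NP.≤-pred x<1+d) x≢d)
  (AllP.filter⁺ (λ x → ¬? (x NP.≟ d)) σ<1+d , AllP.all-filter (λ x → ¬? (x NP.≟ d)) σ)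

All<-∉ : ∀ d (σ : List ℕ) → All (_< suc d) σ → ¬ d ∈ σ → All (_< d) σ
All<-∉ d σ σ<1+d d∉σ = All.zipWith (λ (x<1+d , d≢x) → NP.≤∧≢⇒< (NP.≤-pred x<1+d) (d≢x ∘ sym))
  (σ<1+d , AllP.¬Any⇒All¬ σ d∉σ)

without-↭ : ∀ {d} {σ : List ℕ} → Unique σ → d ∈ σ → σ ↭ d ∷ without d σ
without-↭ {d} {x ∷ σ} (x∉σ ∷ uσ) (here refl) = ↭-prep d (↭-reflexive (sym (begin
    without d (d ∷ σ)    ≡⟨ ListP.filter-reject (λ y → ¬? (y NP.≟ d)) (λ d≢d → d≢d refl) ⟩
    without d σ          ≡⟨ ListP.filter-all (λ y → ¬? (y NP.≟ d)) (All.map (_∘ sym) x∉σ) ⟩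
    σ                    ∎)))
  where open ≡-Reasoning
without-↭ {d} {x ∷ σ} (x∉σ ∷ uσ) (there d∈σ)
  rewrite ListP.filter-accept (λ y → ¬? (y NP.≟ d)) {x} {σ} (λ x≡d → All.lookup x∉σ d∈σ x≡d)
  = ↭-trans (↭-prep x (without-↭ uσ d∈σ)) (↭-swap x d ↭-refl)

pigeonhole : ∀ d (σ : List ℕ) → Unique σ → All (_< d) σ → length σ ≤ d
pigeonhole zero [] _ _ = z≤n
pigeonhole zero (x ∷ σ) _ (() ∷ _)
pigeonhole (suc d) σ uσ σ<1+d with d ∈ℕ? σ
... | yes d∈σ = ≡.subst (_≤ suc d) (sym (↭-length (without-↭ uσ d∈σ)))
                  (s≤s (pigeonhole d (without d σ) (UniqueP.filter⁺ _ uσ) (All<-without d σ σ<1+d)))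
... | no d∉σ = NP.m≤n⇒m≤1+n (pigeonhole d σ uσ (All<-∉ d σ σ<1+d d∉σ))

sum-unique-bounded : ∀ d (σ : List ℕ) → Unique σ → All (_< d) σ → length σ ≡ d → sum σ ≡ triangular d
sum-unique-bounded zero [] _ _ _ = refl
sum-unique-bounded (suc d) σ uσ σ<1+d σ≡1+d with d ∈ℕ? σ
... | yes d∈σ = trans (sum-↭ (without-↭ uσ d∈σ))
                      (cong (d ℕ.+_) (sum-unique-bounded d (without d σ) (UniqueP.filter⁺ _ uσ) (All<-without d σ σ<1+d)
                                        (NP.suc-injective (trans (sym (↭-length (without-↭ uσ d∈σ))) σ≡1+d))))
... | no d∉σ = ⊥-elim (NP.1+n≰n (≡.subst (_≤ d) σ≡1+d (pigeonhole d σ uσ (All<-∉ d σ σ<1+d d∉σ))))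

∈-bijections⁻ : ∀ d {σ} → σ ∈ bijections d → Unique σ × All (_< d) σ × length σ ≡ d
∈-bijections⁻ d σ∈ with σ∈tuples , uσ ← ∈P.∈-filter⁻ (UniqueDec.unique? NP._≟_) {xs = tuples d d} σ∈ =
  uσ , proj₂ (∈-tuples⁻ d d σ∈tuples) , proj₁ (∈-tuples⁻ d d σ∈tuples)

sum-bijection : ∀ d {σ} → σ ∈ bijections d → sum σ ≡ triangular d
sum-bijection d σ∈ with uσ , σ<d , σ≡d ← ∈-bijections⁻ d σ∈ = sum-unique-bounded d _ uσ σ<d σ≡d

module StarLabellings (G : Graph) where
  open Graph G

  labelAt-∉ : (xs : List (Fin m)) (ls : List ℕ) (e : Fin m) → ¬ e ∈ xs → labelAt G xs ls e ≡ 0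
  labelAt-∉ [] ls e _ = refl
  labelAt-∉ (x ∷ xs) [] e _ = refl
  labelAt-∉ (x ∷ xs) (l ∷ ls) e e∉ with x FinP.≟ e
  ... | yes refl = ⊥-elim (e∉ (here refl))
  ... | no _ = labelAt-∉ xs ls e (e∉ ∘ there)

  labelAt-here : (x : Fin m) (xs : List (Fin m)) (l : ℕ) (ls : List ℕ) → labelAt G (x ∷ xs) (l ∷ ls) x ≡ l
  labelAt-here x xs l ls with x FinP.≟ x
  ... | yes _ = refl
  ... | no x≢x = ⊥-elim (x≢x refl)

  labelAt-there : (x : Fin m) (xs : List (Fin m)) (l : ℕ) (ls : List ℕ) (e : Fin m) → e ≢ x →
    labelAt G (x ∷ xs) (l ∷ ls) e ≡ labelAt G xs ls e
  labelAt-there x xs l ls e e≢x with x FinP.≟ e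
  ... | yes x≡e = ⊥-elim (e≢x (sym x≡e))
  ... | no _ = refl

  module Big-labelAt {A : Set} {_∙_ : Op₂ A} {ε : A} (isCM : IsCommutativeMonoid _≡_ _∙_ ε) where
    open CommutativeMonoidSums isCM using (big; big-cong; big-ε; big-extract)

    big-labelAt : (xs : List (Fin m)) → Unique xs → (σ : List ℕ) (φ : Fin m → ℕ → A) → (∀ e → φ e 0 ≡ ε) →
      big (λ e → φ e (labelAt G xs σ e)) ≡ foldr _∙_ ε (zipWith φ xs σ)
    big-labelAt [] _ σ φ φ0≡ε = trans (big-cong φ0≡ε) (big-ε m)
    big-labelAt (x ∷ xs) _ [] φ φ0≡ε = trans (big-cong φ0≡ε) (big-ε m)
    big-labelAt (x ∷ xs) (x∉xs ∷ uxs) (l ∷ ls) φ φ0≡ε =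
      trans (big-extract _ (λ e → φ e (labelAt G xs ls e)) x
               (λ e e≢x → cong (φ e) (labelAt-there x xs l ls e e≢x))
               (trans (cong (φ x) (labelAt-∉ xs ls x (UniqueP.Unique[x∷xs]⇒x∉xs (x∉xs ∷ uxs)))) (φ0≡ε x)))
            (cong₂ _∙_ (cong (φ x) (labelAt-here x xs l ls)) (big-labelAt xs uxs ls φ φ0≡ε))

  open Big-labelAt ZP.*-1-isCommutativeMonoid using () renaming (big-labelAt to ∏-labelAt)
  open Big-labelAt NP.+-0-isCommutativeMonoid using () renaming (big-labelAt to ∑ℕ-labelAt)

  incEdges-unique : ∀ v → Unique (incEdges G v)
  incEdges-unique v = UniqueP.filter⁺ (incident? G v) (UniqueP.allFin⁺ m)

  ∈-incEdges⁺ : ∀ {v e} → Incident G v e → e ∈ incEdges G v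
  ∈-incEdges⁺ {v} {e} = ∈P.∈-filter⁺ (incident? G v) (∈P.∈-allFin e)

  ∈-incEdges⁻ : ∀ {v e} → e ∈ incEdges G v → Incident G v e
  ∈-incEdges⁻ {v} e∈ = proj₂ (∈P.∈-filter⁻ (incident? G v) {xs = allFin m} e∈)

  starLabel-nonEnd : ∀ π e v → v ≢ proj₁ (ends e) → v ≢ proj₂ (ends e) → starLabel G π v e ≡ 0
  starLabel-nonEnd π e v v≢u v≢u′ = labelAt-∉ (incEdges G v) (π v) e ([ v≢u , v≢u′ ]′ ∘ ∈-incEdges⁻)

  ∑-starLabel : ∀ π e → ∑ℕ.big (λ v → starLabel G π v e) ≡ exponent G π e
  ∑-starLabel π e =
    ∑ℕ.big-support₂ (λ v → starLabel G π v e) (proj₁ (ends e)) (proj₂ (ends e)) (loopless e) (starLabel-nonEnd π e)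

  ∏-pow-starLabel : ∀ (x : ℤ) π e → ∏ (λ v → x ^ starLabel G π v e) ≡ x ^ exponent G π e
  ∏-pow-starLabel x π e = begin
      ∏ (λ v → x ^ starLabel G π v e)
    ≡⟨ ∏ℤ.big-support₂ (λ v → x ^ starLabel G π v e) u u′ (loopless e) (λ v v≢u v≢u′ → cong (x ^_) (starLabel-nonEnd π e v v≢u v≢u′)) ⟩
      x ^ starLabel G π u e * x ^ starLabel G π u′ e
    ≡⟨ sym (ZP.^-distribˡ-+-* x (starLabel G π u e) (starLabel G π u′ e)) ⟩
      x ^ exponent G π e ∎
    where
    open ≡-Reasoning
    u = proj₁ (ends e)
    u′ = proj₂ (ends e)

  graphPolynomial : (Fin m → ℤ) → ℤ
  graphPolynomial h = ∑ˡ (starLabellings G) (λ π → sgn G π * ∏ (λ e → h e ^ exponent G π e))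

  starTerm : (Fin m → ℤ) → Fin n → List ℕ → ℤ
  starTerm h v σ = sign σ * ∏ (λ e → h e ^ labelAt G (incEdges G v) σ e)

  term-factorises : ∀ h π → sgn G π * ∏ (λ e → h e ^ exponent G π e) ≡ ∏ (λ v → starTerm h v (π v))
  term-factorises h π = begin
      sgn G π * ∏ (λ e → h e ^ exponent G π e)
    ≡⟨ cong₂ _*_ (∏ℤ.∑ˡ-allFin n (λ v → sign (π v))) (sym (∏ℤ.big-cong (λ e → ∏-pow-starLabel (h e) π e))) ⟩
      ∏ (λ v → sign (π v)) * ∏ (λ e → ∏ (λ v → h e ^ starLabel G π v e))
    ≡⟨ cong (∏ (λ v → sign (π v)) *_) (∏ℤ.big-comm (λ e v → h e ^ starLabel G π v e)) ⟩
      ∏ (λ v → sign (π v)) * ∏ (λ v → ∏ (λ e → h e ^ starLabel G π v e))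
    ≡⟨ sym (∏ℤ.big-distrib (λ v → sign (π v)) (λ v → ∏ (λ e → h e ^ starLabel G π v e))) ⟩
      ∏ (λ v → starTerm h v (π v)) ∎
    where open ≡-Reasoning

  ∑-starTerm : ∀ h v → ∑ˡ (bijections (deg G v)) (starTerm h v) ≡ alternant (deg G v) (map h (incEdges G v))
  ∑-starTerm h v = trans (∑ℤ.∑ˡ-filter (UniqueDec.unique? NP._≟_) (tuples d d) (starTerm h v))
                         (∑ℤ.∑ˡ-cong (tuples d d) (λ σ _ → term σ))
    where
    d = deg G v
    xs = incEdges G v
    term : ∀ σ → (if does (UniqueDec.unique? NP._≟_ σ) then starTerm h v σ else + 0) ≡ leviCivita σ * monomial (map h xs) σ
    term σ with does (UniqueDec.unique? NP._≟_ σ)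
    ... | false = refl
    ... | true = cong (sign σ *_) (begin
        ∏ (λ e → h e ^ labelAt G xs σ e)                 ≡⟨ ∏-labelAt xs (incEdges-unique v) σ (λ e l → h e ^ l) (λ _ → refl) ⟩
        productℤ (zipWith (λ e l → h e ^ l) xs σ)       ≡⟨ cong productℤ (sym (ListP.zipWith-map _^_ h id xs σ)) ⟩
        productℤ (zipWith _^_ (map h xs) (map id σ))    ≡⟨ cong (λ τ → productℤ (zipWith _^_ (map h xs) τ)) (ListP.map-id σ) ⟩
        monomial (map h xs) σ                           ∎)
      where open ≡-Reasoning

  graphPolynomial-factorises : ∀ h → graphPolynomial h ≡ ∏ (λ v → alternant (deg G v) (map h (incEdges G v)))
  graphPolynomial-factorises h = begin
      graphPolynomial h                                             ≡⟨ ∑ℤ.∑ˡ-cong (starLabellings G) (λ π _ → term-factorises h π) ⟩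
      ∑ˡ (starLabellings G) (λ π → ∏ (λ v → starTerm h v (π v)))    ≡⟨ ∑ˡ-choices-∏ n (starLabellingsAt G) (starTerm h) ⟩
      ∏ (λ v → ∑ˡ (bijections (deg G v)) (starTerm h v))            ≡⟨ ∏ℤ.big-cong (∑-starTerm h) ⟩
      ∏ (λ v → alternant (deg G v) (map h (incEdges G v)))          ∎
    where open ≡-Reasoning

  graphPolynomial-improper : ∀ (c : Fin m → ℕ) e e′ → Adjacent G e e′ → c e ≡ c e′ → graphPolynomial (λ e → + c e) ≡ + 0
  graphPolynomial-improper c e e′ (e≢e′ , v , v∼e , v∼e′) ce≡ce′ =
    trans (graphPolynomial-factorises h) (∏-≡0 (λ u → alternant (deg G u) (map h (incEdges G u))) v star-v)
    where
    h : Fin m → ℤ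
    h e = + c e
    star-v : alternant (deg G v) (map h (incEdges G v)) ≡ + 0
    star-v = alternant-repeat (deg G v) (map h (incEdges G v))
               (map-HasRepeat h (∈-incEdges⁺ v∼e) (∈-incEdges⁺ v∼e′) e≢e′ (cong +_ ce≡ce′))
               (ListP.length-map h (incEdges G v))

  exponent-total : ∀ {π} → π ∈ starLabellings G → ∑ℕ.big (exponent G π) ≡ ∑ℕ.big (λ v → triangular (deg G v))
  exponent-total {π} π∈ = begin
      ∑ℕ.big (exponent G π)                                    ≡⟨ ∑ℕ.big-cong (λ e → sym (∑-starLabel π e)) ⟩
      ∑ℕ.big (λ e → ∑ℕ.big (λ v → starLabel G π v e))          ≡⟨ ∑ℕ.big-comm (λ e v → starLabel G π v e) ⟩
      ∑ℕ.big (λ v → ∑ℕ.big (λ e → starLabel G π v e))          ≡⟨ ∑ℕ.big-cong star-sum ⟩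
      ∑ℕ.big (λ v → triangular (deg G v))                      ∎
    where
    open ≡-Reasoning
    star-sum : ∀ v → ∑ℕ.big (λ e → starLabel G π v e) ≡ triangular (deg G v)
    star-sum v with uσ , _ , σ≡d ← ∈-bijections⁻ (deg G v) (∈-choices⁻ n (starLabellingsAt G) π∈ v) = begin
        ∑ℕ.big (λ e → labelAt G (incEdges G v) (π v) e)       ≡⟨ ∑ℕ-labelAt (incEdges G v) (incEdges-unique v) (π v) (λ _ l → l) (λ _ → refl) ⟩
        sum (zipWith (λ _ l → l) (incEdges G v) (π v))        ≡⟨ cong sum (zipWith-snd (incEdges G v) (π v) (sym σ≡d)) ⟩
        sum (π v)                                             ≡⟨ sum-bijection (deg G v) (∈-choices⁻ n (starLabellingsAt G) π∈ v) ⟩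
        triangular (deg G v)                                  ∎

module _ {X : Set} {P Q R : X → Set} (P? : Decidable P) (Q? : Decidable Q) (R? : Decidable R) (f : X → ℤ) where

  private
    ∑Q ∑R¬Q : List X → ℤ
    ∑Q xs = ∑ˡ (filter Q? xs) f
    ∑R¬Q xs = ∑ˡ (filter R? (filter (¬? ∘ Q?) xs)) f

  ∑ˡ-filter-split : (∀ {x} → Q x → P x) → (∀ {x} → ¬ Q x → P x → R x) → (∀ {x} → ¬ Q x → R x → P x) →
    ∀ xs → ∑ˡ (filter P? xs) f ≡ ∑ˡ (filter Q? xs) f + ∑ˡ (filter R? (filter (¬? ∘ Q?) xs)) f
  ∑ˡ-filter-split Q⇒P P⇒R R⇒P [] = refl
  ∑ˡ-filter-split Q⇒P P⇒R R⇒P (x ∷ xs) with Q? x | P? x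
  ... | yes Qx | no ¬Px = ⊥-elim (¬Px (Q⇒P Qx))
  ... | yes _ | yes _ = trans (cong (_+_ (f x)) (∑ˡ-filter-split Q⇒P P⇒R R⇒P xs)) (sym (ZP.+-assoc (f x) (∑Q xs) (∑R¬Q xs)))
  ... | no ¬Qx | P?x with R? x | P?x
  ...   | yes _ | yes _ = trans (cong (_+_ (f x)) (∑ˡ-filter-split Q⇒P P⇒R R⇒P xs)) (ℤ+.x∙yz≈y∙xz (f x) (∑Q xs) (∑R¬Q xs))
  ...   | no ¬Rx | yes Px = ⊥-elim (¬Rx (P⇒R ¬Qx Px))
  ...   | yes Rx | no ¬Px = ⊥-elim (¬Px (R⇒P ¬Qx Rx))
  ...   | no _ | no _ = ∑ˡ-filter-split Q⇒P P⇒R R⇒P xs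

module _ {X : Set} {P Q : X → Set} (P? : Decidable P) (Q? : Decidable Q) where

  filter-filter-⇒ : (∀ {x} → P x → Q x) → ∀ xs → filter P? (filter Q? xs) ≡ filter P? xs
  filter-filter-⇒ P⇒Q [] = refl
  filter-filter-⇒ P⇒Q (x ∷ xs) with Q? x
  ... | yes _ with P? x
  ...   | yes _ = cong (x ∷_) (filter-filter-⇒ P⇒Q xs)
  ...   | no _ = filter-filter-⇒ P⇒Q xs
  filter-filter-⇒ P⇒Q (x ∷ xs) | no ¬Qx = trans (filter-filter-⇒ P⇒Q xs) (sym (ListP.filter-reject P? (¬Qx ∘ P⇒Q)))

_≗?_ : ∀ {m} (w w′ : Fin m → ℕ) → Dec (∀ e → w e ≡ w′ e)
w ≗? w′ = FinP.all? (λ e → w e NP.≟ w′ e)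

module Fibres {X : Set} {m : ℕ} (weight : X → Fin m → ℕ) (f : X → ℤ) where

  fibreSum : List X → (Fin m → ℕ) → ℤ
  fibreSum T w = ∑ˡ (filter (λ x → weight x ≗? w) T) f

  fibreSum-≢0⇒∃ : ∀ T w → fibreSum T w ≢ + 0 → ∃[ x ] (x ∈ T × (∀ e → weight x e ≡ w e))
  fibreSum-≢0⇒∃ T w ∑≢0 with x , x∈ , _ ← ∑ˡ-≢0⇒∃ (filter (λ x → weight x ≗? w) T) f ∑≢0 =
    x , ∈P.∈-filter⁻ (λ x → weight x ≗? w) {xs = T} x∈

  fibreSums-vanish : ∀ k (W : Fin k → Fin m → ℕ) T → (∀ i → fibreSum T (W i) ≡ + 0) →
    ∑ˡ (filter (λ x → FinP.any? (λ i → weight x ≗? W i)) T) f ≡ + 0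
  fibreSums-vanish zero W T _ = cong (λ T′ → ∑ˡ T′ f) (ListP.filter-none _ (All.universal (λ { _ (() , _) }) T))
  fibreSums-vanish (suc k) W T vanish = begin
      ∑ˡ (filter (inW W) T) f
    ≡⟨ ∑ˡ-filter-split (inW W) (atW (W zero)) (inW (W ∘ suc)) f
         (zero ,_) (λ { ¬eq (zero , eq) → ⊥-elim (¬eq eq) ; _ (suc i , eq) → i , eq }) (λ { _ (i , eq) → suc i , eq }) T ⟩
      fibreSum T (W zero) + ∑ˡ (filter (inW (W ∘ suc)) T′) f
    ≡⟨ cong₂ _+_ (vanish zero) (fibreSums-vanish k (W ∘ suc) T′ vanish′) ⟩
      + 0 ∎
    where
    open ≡-Reasoning
    atW : ∀ w x → Dec (∀ e → weight x e ≡ w e)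
    atW w x = weight x ≗? w
    inW : ∀ {k} (W : Fin k → Fin m → ℕ) x → Dec (∃[ i ] (∀ e → weight x e ≡ W i e))
    inW W x = FinP.any? (λ i → weight x ≗? W i)
    T′ = filter (¬? ∘ atW (W zero)) T
    vanish′ : ∀ i → fibreSum T′ (W (suc i)) ≡ + 0
    vanish′ i with W (suc i) ≗? W zero
    ... | yes Wi≗W0 = cong (λ T″ → ∑ˡ T″ f) (ListP.filter-none (atW (W (suc i)))
                        (All.map (λ ¬eq eq → ¬eq (λ e → trans (eq e) (Wi≗W0 e))) (AllP.all-filter (¬? ∘ atW (W zero)) T)))
    ... | no Wi≉W0 = trans (cong (λ T″ → ∑ˡ T″ f) (filter-filter-⇒ (atW (W (suc i))) (¬? ∘ atW (W zero))
                        (λ eq eq₀ → Wi≉W0 (λ e → trans (sym (eq e)) (eq₀ e))) T)) (vanish (suc i))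

module Choosability (G : Graph) where
  open Graph G
  open StarLabellings G
  open Fibres (exponent G) (sgn G)

  S : List (StarLabelling G)
  S = starLabellings G

  nodeChoices : (t : Fin m → ℕ) → List ((e : Fin m) → Fin (suc (t e)))
  nodeChoices t = choices m (λ e → allFin (suc (t e)))

  graphPolynomial-functional : ∀ (t : Fin m → ℕ) (a w : (e : Fin m) → Fin (suc (t e)) → ℤ) →
    ∑ˡ (nodeChoices t) (λ κ → graphPolynomial (λ e → a e (κ e)) * ∏ (λ e → w e (κ e)))
      ≡ ∑ˡ S (λ π → sgn G π * ∏ (λ e → moment (a e) (w e) (exponent G π e)))
  graphPolynomial-functional t a w = begin
      ∑ˡ K (λ κ → ∑ˡ S (λ π → sgn G π * ∏ (x κ π)) * ∏ (wκ κ))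
    ≡⟨ ∑ℤ.∑ˡ-cong K (λ κ _ → sym (∑ˡ-*ʳ S (∏ (wκ κ)) (λ π → sgn G π * ∏ (x κ π)))) ⟩
      ∑ˡ K (λ κ → ∑ˡ S (λ π → (sgn G π * ∏ (x κ π)) * ∏ (wκ κ)))
    ≡⟨ ∑ℤ.∑ˡ-cong K (λ κ _ → ∑ℤ.∑ˡ-cong S (λ π _ → merge κ π)) ⟩
      ∑ˡ K (λ κ → ∑ˡ S (λ π → sgn G π * ∏ (term κ π)))
    ≡⟨ ∑ℤ.∑ˡ-comm K S (λ κ π → sgn G π * ∏ (term κ π)) ⟩
      ∑ˡ S (λ π → ∑ˡ K (λ κ → sgn G π * ∏ (term κ π)))
    ≡⟨ ∑ℤ.∑ˡ-cong S (λ π _ → trans (∑ˡ-*ˡ K (sgn G π) (λ κ → ∏ (term κ π))) (cong (sgn G π *_) (∑-nodeChoices π))) ⟩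
      ∑ˡ S (λ π → sgn G π * ∏ (λ e → moment (a e) (w e) (exponent G π e))) ∎
    where
    open ≡-Reasoning
    K = nodeChoices t
    x : ((e : Fin m) → Fin (suc (t e))) → StarLabelling G → Fin m → ℤ
    x κ π e = a e (κ e) ^ exponent G π e
    wκ : ((e : Fin m) → Fin (suc (t e))) → Fin m → ℤ
    wκ κ e = w e (κ e)
    term : ((e : Fin m) → Fin (suc (t e))) → StarLabelling G → Fin m → ℤ
    term κ π e = x κ π e * wκ κ e
    merge : ∀ κ π → (sgn G π * ∏ (x κ π)) * ∏ (wκ κ) ≡ sgn G π * ∏ (term κ π)
    merge κ π = trans (ZP.*-assoc (sgn G π) (∏ (x κ π)) (∏ (wκ κ))) (cong (sgn G π *_) (sym (∏ℤ.big-distrib (x κ π) (wκ κ))))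
    ∑-nodeChoices : ∀ π → ∑ˡ K (λ κ → ∏ (term κ π)) ≡ ∏ (λ e → moment (a e) (w e) (exponent G π e))
    ∑-nodeChoices π = trans (∑ˡ-choices-∏ m (λ e → allFin (suc (t e))) (λ e k → a e k ^ exponent G π e * w e k))
                            (∏ℤ.big-cong (λ e → ∑ℤ.∑ˡ-allFin (suc (t e)) (λ k → a e k ^ exponent G π e * w e k)))

  coefficient-extraction : ∀ {t : Fin m → ℕ} {π₀} → π₀ ∈ S → (∀ e → exponent G π₀ e ≡ t e) →
    (a w : (e : Fin m) → Fin (suc (t e)) → ℤ) → (∀ e → DetectsDegree (t e) (a e) (w e)) →
    ∑ˡ S (λ π → sgn G π * ∏ (λ e → moment (a e) (w e) (exponent G π e)))
      ≡ fibreSum S t * ∏ (λ e → moment (a e) (w e) (t e))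
  coefficient-extraction {t} {π₀} π₀∈ π₀↦t a w detects = begin
      ∑ˡ S (λ π → sgn G π * ∏ (λ e → Λ e (exponent G π e)))
    ≡⟨ ∑ℤ.∑ˡ-cong S term ⟩
      ∑ˡ S (λ π → if does (exponent G π ≗? t) then sgn G π * D else + 0)
    ≡⟨ sym (∑ℤ.∑ˡ-filter (λ π → exponent G π ≗? t) S (λ π → sgn G π * D)) ⟩
      ∑ˡ (filter (λ π → exponent G π ≗? t) S) (λ π → sgn G π * D)
    ≡⟨ ∑ˡ-*ʳ (filter (λ π → exponent G π ≗? t) S) D (sgn G) ⟩
      fibreSum S t * D ∎
    where
    open ≡-Reasoning
    Λ : (e : Fin m) → ℕ → ℤ
    Λ e = moment (a e) (w e)
    D = ∏ (λ e → Λ e (t e))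
    -- all exponents have the same total ∑ᵥ (0 + 1 + ⋯ + (deg v − 1))
    total : ∀ {π} → π ∈ S → ∑ℕ.big (exponent G π) ≡ ∑ℕ.big t
    total π∈ = trans (exponent-total π∈) (trans (sym (exponent-total π₀∈)) (∑ℕ.big-cong π₀↦t))
    term : ∀ π → π ∈ S → sgn G π * ∏ (λ e → Λ e (exponent G π e)) ≡ (if does (exponent G π ≗? t) then sgn G π * D else + 0)
    term π π∈ = ≡-if-does (exponent G π ≗? t)
      (λ π↦t → cong (sgn G π *_) (∏ℤ.big-cong (λ e → cong (Λ e) (π↦t e))))
      (λ π↛t → let e , πe<te = ∑ℕ-≡⇒∃< (exponent G π) t (total π∈) π↛t in
        trans (cong (sgn G π *_) (∏-≡0 (λ e → Λ e (exponent G π e)) e (proj₁ (detects e) (exponent G π e) πe<te)))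
              (ZP.*-zeroʳ (sgn G π)))

  nonvanishing-point : ∀ (t : Fin m → ℕ) → fibreSum S t ≢ + 0 →
    (a : (e : Fin m) → Fin (suc (t e)) → ℤ) → (∀ e i j → a e i ≡ a e j → i ≡ j) →
    ∃[ κ ] graphPolynomial (λ e → a e (κ e)) ≢ + 0
  nonvanishing-point t coeff≢0 a a-injective = κ , P≢0
    where
    weights : ∀ e → ∃[ w ] DetectsDegree (t e) (a e) w
    weights e = detectingWeights (t e) (a e) (a-injective e)
    w : (e : Fin m) → Fin (suc (t e)) → ℤ
    w e = proj₁ (weights e)
    D≢0 : ∏ (λ e → moment (a e) (w e) (t e)) ≢ + 0
    D≢0 = ∏-≢0 (λ e → moment (a e) (w e) (t e)) (λ e → proj₂ (proj₂ (weights e)))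
    π₀-witness = fibreSum-≢0⇒∃ S t coeff≢0
    identity : ∑ˡ (nodeChoices t) (λ κ → graphPolynomial (λ e → a e (κ e)) * ∏ (λ e → w e (κ e)))
               ≡ fibreSum S t * ∏ (λ e → moment (a e) (w e) (t e))
    identity = trans (graphPolynomial-functional t a w)
                     (coefficient-extraction (proj₁ (proj₂ π₀-witness)) (proj₂ (proj₂ π₀-witness)) a w (λ e → proj₂ (weights e)))
    κ-witness = ∑ˡ-≢0⇒∃ (nodeChoices t) (λ κ → graphPolynomial (λ e → a e (κ e)) * ∏ (λ e → w e (κ e)))
                        (λ ∑≡0 → [ coeff≢0 , D≢0 ]′ (ZP.i*j≡0⇒i≡0∨j≡0 (fibreSum S t) (trans (sym identity) ∑≡0)))
    κ = proj₁ κ-witness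
    P≢0 : graphPolynomial (λ e → a e (κ e)) ≢ + 0
    P≢0 P≡0 = proj₂ (proj₂ κ-witness) (trans (cong (_* ∏ (λ e → w e (κ e))) P≡0) (ZP.*-zeroˡ (∏ (λ e → w e (κ e)))))

  choosable : (t : Fin m → ℕ) → fibreSum S t ≢ + 0 → EdgeChoosable G (λ e → suc (t e))
  choosable t coeff≢0 L uniqueL t<L =
    (λ e → colour e (κ e)) ,
    (λ e e′ e∼e′ same → P≢0 (graphPolynomial-improper (λ e → colour e (κ e)) e e′ e∼e′ same)) ,
    (λ e → ∈P.∈-lookup (inject≤ (κ e) (t<L e)))
    where
    colour : (e : Fin m) → Fin (suc (t e)) → ℕ
    colour e k = lookup (L e) (inject≤ k (t<L e))
    colour-injective : ∀ e i j → + colour e i ≡ + colour e j → i ≡ j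
    colour-injective e i j eq =
      FinP.inject≤-injective (t<L e) (t<L e) i j (lookup-injective (L e) (uniqueL e) _ _ (ZP.+-injective eq))
    point = nonvanishing-point t coeff≢0 (λ e k → + colour e k) colour-injective
    κ = proj₁ point
    P≢0 = proj₂ point

corollary2p3 : (G : Graph) (k : ℕ) (W : Fin k → Fin (Graph.m G) → ℕ) →
    signSum G W ≢ + 0 →
    ∃[ i ] EdgeChoosable G (λ e → suc (W i e))
corollary2p3 G k W signSum≢0 =
  let i , coefficient≢0 = FinP.¬∀⟶∃¬ k _ (λ i → fibreSum S (W i) ZP.≟ + 0) (signSum≢0 ∘ fibreSums-vanish k W S)
  in i , choosable (W i) coefficient≢0
  where
  open Choosability G
  open Fibres (exponent G) (sgn G)
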